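{- Let $T$ be a finite set of independence atoms, each of the form $u\ \bot\ v$ for variables $u,v$ (possibly equal), and let $x,y$ be variables. Then $y\ \bot\ x$ is derivable from $T$ using the Independence Axioms (Symmetry Rule and Constancy Rule) if and only if every team (over every structure) that satisfies all atoms in $T$ also satisfies $y\ \bot\ x$.
   Context: A team $X$ over a structure $M$ is a set of assignments $s$ from a common set of variables into the domain of $M$ (the domain containing all variables under consideration). A team $X$ satisfies the atom $x\ \bot\ y$ if for all $s,s'\in X$ there is $s''\in X$ with $s''(y)=s(y)$ and $s''(x)=s'(x)$. The Independence Axioms are the two rules: (Symmetry Rule) from $x\ \bot\ y$ infer $y\ \bot\ x$; (Constancy Rule) from $x\ \bot\ x$ infer $y\ \bot\ x$. "Derivable from $T$" means obtainable from members of $T$ by finitely many applications of these rules. -}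

module Defs where

open import Data.Nat using (ℕ)
open import Data.Product using (Σ; _×_; _,_)
open import Data.List using (List)
open import Data.List.Membership.Propositional using (_∈_)
open import Relation.Binary.PropositionalEquality using (_≡_)

Var : Set
Var = ℕ

data Atom : Set where
  _⊥ᵢ_ : Var → Var → Atom

Assignment : Set → Set
Assignment D = Var → D

Team : Set → Set₁
Team D = Assignment D → Set

_⊨_ : {D : Set} → Team D → Atom → Set
_⊨_ {D} X (x ⊥ᵢ y) =
  (s s' : Assignment D) → X s → X s' →
  Σ (Assignment D) λ s'' → X s'' × (s'' y ≡ s y) × (s'' x ≡ s' x)

_⊨all_ : {D : Set} → Team D → List Atom → Set
X ⊨all T = ∀ {a} → a ∈ T → X ⊨ a

data _⊢_ (T : List Atom) : Atom → Set where
  assumption : ∀ {a} → a ∈ T → T ⊢ a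
  symmetry   : ∀ {x y} → T ⊢ (x ⊥ᵢ y) → T ⊢ (y ⊥ᵢ x)
  constancy  : ∀ {x y} → T ⊢ (x ⊥ᵢ x) → T ⊢ (y ⊥ᵢ x)

-- Soundness: the Symmetry Rule is sound since the atom's definition is symmetric
-- in its two sides, and the Constancy Rule since x ⊥ x forces x to be constant
-- on the team, and a constant variable is independent of everything.
-- Completeness: if y ⊥ x is not derivable, no atom of T has both sides in
-- {x, y}, since each such atom derives y ⊥ x. The Boolean team of all
-- assignments with s x = s y that vanish outside {x, y} then satisfies T, every
-- atom of T having a side that is constant on it, but it violates y ⊥ x.
module Submission where

open import Defs
open import Data.Bool using (Bool; true; false)
open import Data.Empty using (⊥-elim)
open import Data.List using (List)
open import Data.List.Membership.Propositional using (_∈_; lose; find)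
open import Data.List.Relation.Unary.Any using (any?)
open import Data.Product using (_×_; _,_)
open import Data.Sum using (_⊎_; inj₁; inj₂)
open import Data.Nat using (_≟_)
open import Relation.Nullary using (Dec; yes; no; ¬_; does)
open import Relation.Nullary.Decidable using (dec-true; dec-false; _⊎-dec_; _×-dec_)
open import Relation.Binary.PropositionalEquality using (_≡_; _≢_; refl; sym; trans; module ≡-Reasoning)

Constant : {D : Set} → Team D → Var → Set
Constant {D} X z = (s s' : Assignment D) → X s → X s' → s z ≡ s' z

module _ {D : Set} {X : Team D} where

  ⊨-sym : ∀ {u v} → X ⊨ (u ⊥ᵢ v) → X ⊨ (v ⊥ᵢ u)
  ⊨-sym h s s' p p' with h s' s p' p
  ... | s'' , q , e , e' = s'' , q , e' , e

  ⊨-constantˡ : ∀ {u v} → Constant X u → X ⊨ (u ⊥ᵢ v)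
  ⊨-constantˡ c s s' p p' = s , p , refl , c s s' p p'

  ⊨-constantʳ : ∀ {u v} → Constant X v → X ⊨ (u ⊥ᵢ v)
  ⊨-constantʳ c = ⊨-sym (⊨-constantˡ c)

  ⊨-self⇒constant : ∀ {u} → X ⊨ (u ⊥ᵢ u) → Constant X u
  ⊨-self⇒constant h s s' p p' with h s s' p p'
  ... | _ , _ , e , e' = trans (sym e) e'

  ⊢-sound : ∀ {T a} → T ⊢ a → X ⊨all T → X ⊨ a
  ⊢-sound (assumption a∈T) ⊨T = ⊨T a∈T
  ⊢-sound (symmetry d)     ⊨T = ⊨-sym (⊢-sound d ⊨T)
  ⊢-sound (constancy d)    ⊨T = ⊨-constantʳ (⊨-self⇒constant (⊢-sound d ⊨T))

module _ (x y : Var) where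

  Among : Var → Set
  Among z = z ≡ x ⊎ z ≡ y

  among? : ∀ z → Dec (Among z)
  among? z = (z ≟ x) ⊎-dec (z ≟ y)

  Inside : Atom → Set
  Inside (u ⊥ᵢ v) = Among u × Among v

  inside? : ∀ a → Dec (Inside a)
  inside? (u ⊥ᵢ v) = among? u ×-dec among? v

  ⊢-inside : ∀ {T a} → T ⊢ a → Inside a → T ⊢ (y ⊥ᵢ x)
  ⊢-inside {a = _ ⊥ᵢ _} d (inj₁ refl , inj₁ refl) = constancy d
  ⊢-inside {a = _ ⊥ᵢ _} d (inj₁ refl , inj₂ refl) = symmetry d
  ⊢-inside {a = _ ⊥ᵢ _} d (inj₂ refl , inj₁ refl) = d
  ⊢-inside {a = _ ⊥ᵢ _} d (inj₂ refl , inj₂ refl) = symmetry (constancy d)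

  diagonal : Team Bool
  diagonal s = s x ≡ s y × (∀ z → ¬ Among z → s z ≡ false)

  outside⇒constant : ∀ {z} → ¬ Among z → Constant diagonal z
  outside⇒constant {z} ∉ _ _ (_ , p) (_ , p') = trans (p z ∉) (sym (p' z ∉))

  diagonal-⊨-outside : ∀ {a} → ¬ Inside a → diagonal ⊨ a
  diagonal-⊨-outside {u ⊥ᵢ v} ¬in with among? u
  ... | yes u∈ = ⊨-constantʳ (outside⇒constant λ v∈ → ¬in (u∈ , v∈))
  ... | no u∉  = ⊨-constantˡ (outside⇒constant u∉)

  indicator : Assignment Bool
  indicator z = does (among? z)

  indicator-among : ∀ {z} → Among z → indicator z ≡ true
  indicator-among {z} = dec-true (among? z)

  indicator∈diagonal : diagonal indicator
  indicator∈diagonal =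
    trans (indicator-among (inj₁ refl)) (sym (indicator-among (inj₂ refl))) ,
    λ z → dec-false (among? z)

  diagonal-⊭ : ¬ diagonal ⊨ (y ⊥ᵢ x)
  diagonal-⊭ h with h (λ _ → false) indicator (refl , λ _ _ → refl) indicator∈diagonal
  ... | s , (sx≡sy , _) , sx≡false , sy≡indicator-y = false≢true (begin
    false       ≡⟨ sym sx≡false ⟩
    s x         ≡⟨ sx≡sy ⟩
    s y         ≡⟨ sy≡indicator-y ⟩
    indicator y ≡⟨ indicator-among (inj₂ refl) ⟩
    true        ∎)
    where
    open ≡-Reasoning
    false≢true : false ≢ true
    false≢true ()

  ⊢-complete : ∀ {T} → ((D : Set) (X : Team D) → X ⊨all T → X ⊨ (y ⊥ᵢ x)) → T ⊢ (y ⊥ᵢ x)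
  ⊢-complete {T} ⊨⇒⊨ with any? inside? T
  ... | yes some-inside = let _ , a∈T , a-in = find some-inside in ⊢-inside (assumption a∈T) a-in
  ... | no none-inside =
    ⊥-elim (diagonal-⊭ (⊨⇒⊨ Bool diagonal λ a∈T → diagonal-⊨-outside λ a-in → none-inside (lose a∈T a-in)))

theorem4 : (T : List Atom) (x y : Var) →
    (T ⊢ (y ⊥ᵢ x) → ((D : Set) (X : Team D) → X ⊨all T → X ⊨ (y ⊥ᵢ x)))
    × (((D : Set) (X : Team D) → X ⊨all T → X ⊨ (y ⊥ᵢ x)) → T ⊢ (y ⊥ᵢ x))
theorem4 T x y = (λ d D X → ⊢-sound d) , ⊢-complete x y
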